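{- Let $P$ be a finite set partially ordered by $\leq$. For every $P$-labelled tree $(N,E,\lambda)$ that is not strict, there exists a $P$-labelled tree $(N',E',\lambda')$ with $N'\subsetneq N$ and $(N,E,\lambda)\sim(N',E',\lambda')$.
   Context: A $P$-labelled tree is a triple $(N,E,\lambda)$ where $(N,E)$ is a finite (rooted) tree with edge relation $E$ (parent to child) and $\lambda:N\to P$ satisfies $\lambda(i)\leq\lambda(j)$ whenever $iEj$. It is strict if $iEj$ implies $\lambda(i)<\lambda(j)$ (i.e. $\lambda(i)\leq\lambda(j)$ and $\lambda(i)\neq\lambda(j)$). A $P$-embedding of $(N,E,\lambda)$ into $(N',E',\lambda')$ is a function $f:N\to N'$ such that $iEj$ implies $f(i)\,E'^{\star}\,f(j)$ ($E'^{\star}$ the reflexive-transitive closure of $E'$) and $\lambda(k)=\lambda'(f(k))$ for all $k$; $\sim$ holds iff there are $P$-embeddings in both directions. -}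

module Defs where

open import Level using (Level; _⊔_)
open import Data.Nat using (ℕ)
open import Data.Fin using (Fin)
open import Data.Fin.Subset using (Subset; _∈_)
open import Data.Product using (Σ; _×_; ∃)
open import Function.Bundles using (_↔_)
open import Relation.Binary.Core using (Rel)
open import Relation.Binary.Structures using (IsPartialOrder)
open import Relation.Binary.PropositionalEquality using (_≡_; _≢_)
open import Relation.Binary.Construct.Closure.ReflexiveTransitive using (Star)
open import Relation.Nullary using (¬_)

record FinitePoset (c ℓ : Level) : Set (Level.suc (c ⊔ ℓ)) where
  field
    Carrier        : Set c
    _≤_            : Rel Carrier ℓ
    isPartialOrder : IsPartialOrder _≡_ _≤_
    size           : ℕ
    finite         : Fin size ↔ Carrier

record IsRootedTree {ℓ : Level} (n : ℕ) (N : Subset n) (E : Rel (Fin n) ℓ) : Set ℓ where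
  field
    edges-in-N    : ∀ {i j} → E i j → (i ∈ N) × (j ∈ N)
    root          : Fin n
    root∈N        : root ∈ N
    root-no-parent : ∀ i → ¬ E i root
    parent        : ∀ j → j ∈ N → j ≢ root → ∃ λ i → E i j
    parent-unique : ∀ {i i′ j} → E i j → E i′ j → i ≡ i′
    reachable     : ∀ j → j ∈ N → Star E root j

module _ {c ℓ : Level} (P : FinitePoset c ℓ) where
  open FinitePoset P

  record LabelledTree (n : ℕ) : Set (Level.suc (c ⊔ ℓ)) where
    field
      N       : Subset n
      E       : Rel (Fin n) (c ⊔ ℓ)
      isTree  : IsRootedTree n N E
      label   : Fin n → Carrier
      monotone : ∀ {i j} → E i j → label i ≤ label j

  open LabelledTree

  Strict : ∀ {n} → LabelledTree n → Set (c ⊔ ℓ)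
  Strict T = ∀ {i j} → E T i j → (label T i ≤ label T j) × (label T i ≢ label T j)

  IsEmbedding : ∀ {n} → LabelledTree n → LabelledTree n → (Fin n → Fin n) → Set (c ⊔ ℓ)
  IsEmbedding T T′ f =
      (∀ k → k ∈ N T → f k ∈ N T′)
    × (∀ {i j} → E T i j → Star (E T′) (f i) (f j))
    × (∀ k → k ∈ N T → label T k ≡ label T′ (f k))

  Embeds : ∀ {n} → LabelledTree n → LabelledTree n → Set (c ⊔ ℓ)
  Embeds T T′ = Σ (Fin _ → Fin _) (IsEmbedding T T′)

  _∼_ : ∀ {n} → LabelledTree n → LabelledTree n → Set (c ⊔ ℓ)
  T ∼ T′ = Embeds T T′ × Embeds T′ T

-- If an edge p → j carries equal labels λ(p) = λ(j), contract it: delete j and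
-- hang its children under p. The identity embeds the contracted tree into the
-- original one (an edge p → c of the new tree is the path p → j → c), and
-- sending j to p embeds the original tree into the contracted one, preserving
-- labels precisely because λ(p) = λ(j). Non-strictness is only given
-- negatively, so such an edge is found by exhaustive search over the finitely
-- many nodes; this needs decidable equality of labels, which finiteness of P gives.
module Submission where

open import Defs
open import Level using (Level)
open import Data.Nat using (ℕ)
open import Data.Fin.Subset using (_⊂_)
open import Data.Product using (∃; _×_)
open import Relation.Nullary using (¬_)

open import Data.Bool.Base using (if_then_else_)
open import Data.Empty using (⊥-elim)
open import Data.Fin.Base using (Fin; zero; suc)
open import Data.Fin.Properties using (any?) renaming (_≟_ to _≟ᶠ_)
open import Data.Fin.Subset using (Subset; _∈_; _∉_; _-_)
open import Data.Fin.Subset.Properties using (_∈?_; x∈p∧x≢y⇒x∈p-y; x∈p⇒p-x⊂p)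
open import Data.Product using (∃₂; _,_; proj₁; proj₂)
open import Data.Sum using (_⊎_; inj₁; inj₂)
open import Data.Vec.Base using (_∷_; there)
open import Function.Base using (id)
open import Function.Properties.Inverse using (↔-sym; ↔⇒↣)
open import Relation.Binary.Core using (Rel)
open import Relation.Binary.Definitions using (DecidableEquality)
open import Relation.Binary.Construct.Closure.ReflexiveTransitive using (Star; ε; _◅_)
open import Relation.Binary.PropositionalEquality using (_≡_; _≢_; refl; sym; subst; ≢-sym)
open import Relation.Binary.Structures using (IsPartialOrder)
open import Relation.Nullary using (Dec; yes; no; does)
open import Relation.Nullary.Decidable using (via-injection)
open import Relation.Unary using (Pred; Decidable)

y∉p-y : ∀ {n} (p : Subset n) (y : Fin n) → y ∉ p - y
y∉p-y (_ ∷ p) zero    ()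
y∉p-y (_ ∷ p) (suc y) (there y∈p-y) = y∉p-y p y y∈p-y

x∈p-y⇒x≢y : ∀ {n} {p : Subset n} {x y : Fin n} → x ∈ p - y → x ≢ y
x∈p-y⇒x≢y {p = p} {y = y} x∈p-y refl = y∉p-y p y x∈p-y

last-step : ∀ {a ℓ} {A : Set a} {R : Rel A ℓ} → DecidableEquality A →
            ∀ {x y} → Star R x y → x ≢ y → ∃ λ z → R z y × z ≢ y
last-step _≟_ ε x≢y = ⊥-elim (x≢y refl)
last-step _≟_ {x} {y} (_◅_ {j = z} xRz z⋆y) x≢y with z ≟ y
... | yes refl = x , xRz , x≢y
... | no z≢y   = last-step _≟_ z⋆y z≢y

module RootedTree {ℓ} {n : ℕ} {N : Subset n} {E : Rel (Fin n) ℓ} (tree : IsRootedTree n N E) where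
  open IsRootedTree tree

  child≢root : ∀ {i j} → E i j → j ≢ root
  child≢root {i} i→j refl = root-no-parent i i→j

  -- The path from the root enters i from some k ≢ i, yet i is the unique parent of i.
  E-irrefl : ∀ {i} → ¬ E i i
  E-irrefl i→i with last-step _≟ᶠ_ (reachable _ (proj₂ (edges-in-N i→i))) (≢-sym (child≢root i→i))
  ... | k , k→i , k≢i = k≢i (parent-unique k→i i→i)

  parent? : ∀ {q} {Q : Pred (Fin n) q} → Decidable Q → ∀ j → Dec (∃ λ i → E i j × Q i)
  parent? {Q = Q} Q? j with j ∈? N | j ≟ᶠ root
  ... | no j∉N  | _        = no λ (_ , i→j , _) → j∉N (proj₂ (edges-in-N i→j))
  ... | yes _   | yes refl = no λ (_ , i→j , _) → child≢root i→j refl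
  ... | yes j∈N | no j≢root with parent j j∈N j≢root
  ... | i , i→j with Q? i
  ...   | yes Qi = yes (i , i→j , Qi)
  ...   | no ¬Qi = no λ (i′ , i′→j , Qi′) → ¬Qi (subst Q (parent-unique i′→j i→j) Qi′)

  module Contraction {p j : Fin n} (p→j : E p j) where
    p≢j : p ≢ j
    p≢j refl = E-irrefl p→j

    child-of-j≢j : ∀ {y} → E j y → y ≢ j
    child-of-j≢j j→y refl = E-irrefl j→y

    root≢j : root ≢ j
    root≢j = ≢-sym (child≢root p→j)

    N′ : Subset n
    N′ = N - j

    N′⊂N : N′ ⊂ N
    N′⊂N = x∈p⇒p-x⊂p (proj₂ (edges-in-N p→j))

    E′ : Rel (Fin n) ℓ
    E′ x y = (E x y × x ≢ j × y ≢ j) ⊎ (x ≡ p × E j y)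

    Star-E⇒Star-E′ : ∀ {a b} → Star E a b → a ≢ j → b ≢ j → Star E′ a b
    Star-E⇒Star-E′ ε _ _ = ε
    Star-E⇒Star-E′ (_◅_ {j = x} a→x x⋆b) a≢j b≢j with x ≟ᶠ j
    Star-E⇒Star-E′ (a→j ◅ ε)            a≢j b≢j | yes refl = ⊥-elim (b≢j refl)
    Star-E⇒Star-E′ (a→j ◅ (j→y ◅ y⋆b)) a≢j b≢j | yes refl =
      inj₂ (parent-unique a→j p→j , j→y) ◅ Star-E⇒Star-E′ y⋆b (child-of-j≢j j→y) b≢j
    Star-E⇒Star-E′ (a→x ◅ x⋆b)          a≢j b≢j | no x≢j =
      inj₁ (a→x , a≢j , x≢j) ◅ Star-E⇒Star-E′ x⋆b x≢j b≢j

    E′⇒Star-E : ∀ {x y} → E′ x y → Star E x y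
    E′⇒Star-E (inj₁ (x→y , _))     = x→y ◅ ε
    E′⇒Star-E (inj₂ (refl , j→y)) = p→j ◅ j→y ◅ ε

    isRootedTree′ : IsRootedTree n N′ E′
    isRootedTree′ = record
      { edges-in-N     = edges-in-N′
      ; root           = root
      ; root∈N         = x∈p∧x≢y⇒x∈p-y root∈N root≢j
      ; root-no-parent = λ { i (inj₁ (i→root , _)) → root-no-parent i i→root
                           ; i (inj₂ (_ , j→root)) → root-no-parent j j→root }
      ; parent         = parent′
      ; parent-unique  = parent-unique′
      ; reachable      = λ y y∈N′ →
          Star-E⇒Star-E′ (reachable y (proj₁ N′⊂N y∈N′)) root≢j (x∈p-y⇒x≢y y∈N′)
      }
      where
      edges-in-N′ : ∀ {x y} → E′ x y → (x ∈ N′) × (y ∈ N′)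
      edges-in-N′ (inj₁ (x→y , x≢j , y≢j)) =
        x∈p∧x≢y⇒x∈p-y (proj₁ (edges-in-N x→y)) x≢j , x∈p∧x≢y⇒x∈p-y (proj₂ (edges-in-N x→y)) y≢j
      edges-in-N′ (inj₂ (refl , j→y)) =
        x∈p∧x≢y⇒x∈p-y (proj₁ (edges-in-N p→j)) p≢j ,
        x∈p∧x≢y⇒x∈p-y (proj₂ (edges-in-N j→y)) (child-of-j≢j j→y)

      parent′ : ∀ y → y ∈ N′ → y ≢ root → ∃ λ i → E′ i y
      parent′ y y∈N′ y≢root with parent y (proj₁ N′⊂N y∈N′) y≢root
      ... | i , i→y with i ≟ᶠ j
      ...   | yes refl = p , inj₂ (refl , i→y)
      ...   | no i≢j   = i , inj₁ (i→y , i≢j , x∈p-y⇒x≢y y∈N′)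

      parent-unique′ : ∀ {i i′ y} → E′ i y → E′ i′ y → i ≡ i′
      parent-unique′ (inj₁ (i→y , _))        (inj₁ (i′→y , _))        = parent-unique i→y i′→y
      parent-unique′ (inj₁ (i→y , i≢j , _))  (inj₂ (_ , j→y))         = ⊥-elim (i≢j (parent-unique i→y j→y))
      parent-unique′ (inj₂ (_ , j→y))        (inj₁ (i′→y , i′≢j , _)) = ⊥-elim (i′≢j (parent-unique i′→y j→y))
      parent-unique′ (inj₂ (refl , _))       (inj₂ (refl , _))        = refl

    merge : Fin n → Fin n
    merge k = if does (k ≟ᶠ j) then p else k

    merge∈N′ : ∀ {k} → k ∈ N → merge k ∈ N′
    merge∈N′ {k} k∈N with k ≟ᶠ j
    ... | yes _   = x∈p∧x≢y⇒x∈p-y (proj₁ (edges-in-N p→j)) p≢j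
    ... | no k≢j = x∈p∧x≢y⇒x∈p-y k∈N k≢j

    merge-preserves-E : ∀ {x y} → E x y → Star E′ (merge x) (merge y)
    merge-preserves-E {x} {y} x→y with x ≟ᶠ j | y ≟ᶠ j
    ... | yes refl | yes refl = ⊥-elim (E-irrefl x→y)
    ... | yes refl | no y≢j   = inj₂ (refl , x→y) ◅ ε
    ... | no x≢j   | yes refl with parent-unique x→y p→j
    ...   | refl = ε
    merge-preserves-E x→y | no x≢j | no y≢j = inj₁ (x→y , x≢j , y≢j) ◅ ε

module _ {c ℓ : Level} (P : FinitePoset c ℓ) where
  open FinitePoset P
  open IsPartialOrder isPartialOrder using () renaming (trans to ≤-trans)

  _≟_ : DecidableEquality Carrier
  _≟_ = via-injection (↔⇒↣ (↔-sym finite)) _≟ᶠ_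

  module _ {n : ℕ} (T : LabelledTree P n) where
    open LabelledTree T
    open RootedTree isTree

    ¬strict⇒constant-edge : ¬ Strict P T → ∃₂ λ i j → E i j × label i ≡ label j
    ¬strict⇒constant-edge ¬strict with any? (λ j → parent? (λ i → label i ≟ label j) j)
    ... | yes (j , i , i→j , λi≡λj) = i , j , i→j , λi≡λj
    ... | no ∄constant-edge =
      ⊥-elim (¬strict λ {i} {j} i→j → monotone i→j , λ λi≡λj → ∄constant-edge (j , i , i→j , λi≡λj))

    module _ {p j : Fin n} (p→j : E p j) where
      open Contraction p→j

      contracted : LabelledTree P n
      contracted = record
        { N        = N′
        ; E        = E′
        ; isTree   = isRootedTree′
        ; label    = label
        ; monotone = λ { (inj₁ (x→y , _))     → monotone x→y
                       ; (inj₂ (refl , j→y)) → ≤-trans (monotone p→j) (monotone j→y) }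
        }

      contracted⊂T : LabelledTree.N contracted ⊂ N
      contracted⊂T = N′⊂N

      contracted↪T : Embeds P contracted T
      contracted↪T = id , (λ _ → proj₁ N′⊂N) , E′⇒Star-E , (λ _ _ → refl)

      T↪contracted : label p ≡ label j → Embeds P T contracted
      T↪contracted λp≡λj = merge , (λ _ → merge∈N′) , merge-preserves-E , (λ k _ → label≡label∘merge k)
        where
        label≡label∘merge : ∀ k → label k ≡ label (merge k)
        label≡label∘merge k with k ≟ᶠ j
        ... | yes refl = sym λp≡λj
        ... | no _     = refl

lemma2 : ∀ {c ℓ : Level} (P : FinitePoset c ℓ) {n : ℕ} (T : LabelledTree P n) →
    ¬ Strict P T →
    ∃ λ (T′ : LabelledTree P n) → (LabelledTree.N T′ ⊂ LabelledTree.N T) × _∼_ P T T′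
lemma2 P T ¬strict with ¬strict⇒constant-edge P T ¬strict
... | p , j , p→j , λp≡λj =
  contracted P T p→j , contracted⊂T P T p→j , T↪contracted P T p→j λp≡λj , contracted↪T P T p→j
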